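{- Let $N$ and $m$ be integers with $1\le m$ and $2m\le N$, and let $M$ be the matching $\{1,2\},\{3,4\},\ldots,\{2m-1,2m\}$. The number of graphs on vertex set $[N]$ in which $M$ is a maximum matching is less than $$2^{2m^2-2m}\,\bigl(N-2m+2^{N-2m+1}\bigr)^{m}.$$
   Context: A graph on $[N]$ contains $M$ as a maximum matching if all edges of $M$ are edges of the graph and the graph has no matching with more than $m$ edges. -}

module Defs where

open import Data.Nat using (ℕ; suc; _+_; _*_; _≤_; _<_)
open import Data.Fin using (Fin; toℕ)
open import Data.Bool using (Bool; true; false)
open import Data.Vec using (Vec; lookup)
open import Data.Product using (Σ; _×_; proj₁; proj₂)
open import Relation.Binary.PropositionalEquality using (_≡_; _≢_)

-- A graph on vertex set [N] is represented by its adjacency matrix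
-- (vertex k of the paper is  Fin N  element with toℕ = k - 1).
AdjMatrix : ℕ → Set
AdjMatrix N = Vec (Vec Bool N) N

entry : ∀ {N} → AdjMatrix N → Fin N → Fin N → Bool
entry A i j = lookup (lookup A i) j

IsSimpleGraph : ∀ {N} → AdjMatrix N → Set
IsSimpleGraph {N} A =
  ((i : Fin N) → entry A i i ≡ false) ×
  ((i j : Fin N) → entry A i j ≡ entry A j i)

Adj : ∀ {N} → AdjMatrix N → Fin N → Fin N → Set
Adj A i j = entry A i j ≡ true

AdjNat : ∀ {N} → AdjMatrix N → ℕ → ℕ → Set
AdjNat {N} A a b =
  Σ (Fin N) λ i → Σ (Fin N) λ j → (toℕ i ≡ a) × (toℕ j ≡ b) × Adj A i j

IsMatching : ∀ {N k} → AdjMatrix N → (Fin k → Fin N × Fin N) → Set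
IsMatching {N} {k} A es =
  ((e : Fin k) → Adj A (proj₁ (es e)) (proj₂ (es e))) ×
  ((e f : Fin k) → e ≢ f →
     (proj₁ (es e) ≢ proj₁ (es f)) × (proj₁ (es e) ≢ proj₂ (es f)) ×
     (proj₂ (es e) ≢ proj₁ (es f)) × (proj₂ (es e) ≢ proj₂ (es f)))

-- M = {1,2},{3,4},...,{2m-1,2m}  (0-based: {2i, 2i+1} for i < m)
ContainsM : ∀ {N} → ℕ → AdjMatrix N → Set
ContainsM m A = (i : ℕ) → i < m → AdjNat A (2 * i) (2 * i + 1)

NoLargerMatching : ∀ {N} → ℕ → AdjMatrix N → Set
NoLargerMatching {N} m A =
  (k : ℕ) (es : Fin k → Fin N × Fin N) → IsMatching A es → k ≤ m

HasMaxMatchingM : ∀ {N} → ℕ → AdjMatrix N → Set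
HasMaxMatchingM m A = IsSimpleGraph A × ContainsM m A × NoLargerMatching m A

-- Let U be the n = N − 2m vertices outside M. Maximality of M makes U independent, and for
-- every edge {a, b} of M it leaves only three shapes for the U-neighbourhoods of a and b:
-- that of a is empty, or that of b is empty, or both are the same single vertex. These are
-- 2^n + (2^n − 1) + n < n + 2^(n+1) possibilities per edge of M. The only other free entries
-- are the 4 adjacencies between any two edges of M, 2m(m − 1) bits in all. Hence a graph in
-- which M is a maximum matching is determined by a number below 2^(2m²−2m) (n + 2^n + 2^n − 1)^m,
-- and pigeonhole bounds the number of such graphs.
module Submission where

open import Defs
open import Data.Bool using (Bool; true; false; if_then_else_)
open import Data.Empty using (⊥-elim)
open import Data.Fin using (Fin; toℕ; fromℕ<) renaming (_<_ to _<ᶠ_)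
open import Data.Fin.Properties using (toℕ<n; toℕ-injective; toℕ-fromℕ<; pigeonhole)
open import Data.List using (List; length; lookup)
open import Data.List.Membership.Propositional.Properties using (∈-lookup)
open import Data.List.Relation.Unary.All as All using (All)
open import Data.List.Relation.Unary.AllPairs as AllPairs using ()
open import Data.List.Relation.Unary.Unique.Propositional using (Unique)
open import Data.Nat
open import Data.Nat.Properties
open import Data.Nat.Tactic.RingSolver using (solve-∀)
open import Data.Product using (_×_; _,_; proj₁; proj₂; ∃₂)
open import Data.Sum using (inj₁; inj₂)
open import Data.Vec as Vec using (Vec; []; _∷_; replicate)
open import Data.Vec.Properties using (tabulate∘lookup; tabulate-cong)
open import Function using (_∘_)
open import Relation.Binary.Definitions using (tri<; tri≈; tri>)
open import Relation.Binary.PropositionalEquality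
open import Relation.Nullary using (¬_; yes; no; does; contradiction)
open import Relation.Nullary.Decidable using (dec-true; dec-false)

d+b*e<b*E : ∀ {d b e E} → d < b → e < E → d + b * e < b * E
d+b*e<b*E {d} {b} {e} {E} d<b e<E = begin-strict
  d + b * e <⟨ +-monoˡ-< (b * e) d<b ⟩
  b + b * e ≡⟨ *-suc b e ⟨
  b * suc e ≤⟨ *-monoʳ-≤ b e<E ⟩
  b * E     ∎
  where open ≤-Reasoning

d+b*e-injective : ∀ {d d' b e e'} → d < b → d' < b →
  d + b * e ≡ d' + b * e' → d ≡ d' × e ≡ e'
d+b*e-injective {d} {d'} {b} {e} {e'} d<b d'<b eq with <-cmp e e'
... | tri≈ _ refl _ = +-cancelʳ-≡ (b * e) d d' eq , refl
... | tri< e<e' _ _ = ⊥-elim (<-irrefl eq (<-≤-trans (d+b*e<b*E d<b e<e') (m≤n+m (b * e') d')))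
... | tri> _ _ e>e' = ⊥-elim (<-irrefl (sym eq) (<-≤-trans (d+b*e<b*E d'<b e>e') (m≤n+m (b * e) d)))

∏< : ℕ → (ℕ → ℕ) → ℕ
∏< zero    b = 1
∏< (suc k) b = b k * ∏< k b

mixedRadix : ℕ → (ℕ → ℕ) → (ℕ → ℕ) → ℕ
mixedRadix zero    b d = 0
mixedRadix (suc k) b d = d k + b k * mixedRadix k b d

mixedRadix<∏ : ∀ k b d → (∀ i → i < k → d i < b i) → mixedRadix k b d < ∏< k b
mixedRadix<∏ zero    b d d<b = z<s
mixedRadix<∏ (suc k) b d d<b =
  d+b*e<b*E (d<b k ≤-refl) (mixedRadix<∏ k b d (λ i i<k → d<b i (m<n⇒m<1+n i<k)))

mixedRadix-injective : ∀ k b d d' → (∀ i → i < k → d i < b i) → (∀ i → i < k → d' i < b i) →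
  mixedRadix k b d ≡ mixedRadix k b d' → ∀ i → i < k → d i ≡ d' i
mixedRadix-injective (suc k) b d d' d<b d'<b eq i i<1+k
  with d+b*e-injective (d<b k ≤-refl) (d'<b k ≤-refl) eq | m<1+n⇒m<n∨m≡n i<1+k
... | dk≡d'k , _    | inj₂ refl = dk≡d'k
... | _ , rest≡rest | inj₁ i<k  = mixedRadix-injective k b d d'
  (λ j j<k → d<b j (m<n⇒m<1+n j<k)) (λ j j<k → d'<b j (m<n⇒m<1+n j<k)) rest≡rest i i<k

∏<-const : ∀ L c → ∏< L (λ _ → c) ≡ c ^ L
∏<-const zero    c = refl
∏<-const (suc L) c = cong (c *_) (∏<-const L c)

bit : Bool → ℕ
bit false = 0
bit true  = 1

bit<2 : ∀ x → bit x < 2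
bit<2 false = s≤s z≤n
bit<2 true  = s≤s (s≤s z≤n)

bit-injective : ∀ {x y} → bit x ≡ bit y → x ≡ y
bit-injective {false} {false} _ = refl
bit-injective {true}  {true}  _ = refl

bits : ℕ → (ℕ → Bool) → ℕ
bits L f = mixedRadix L (λ _ → 2) (bit ∘ f)

bits<2^ : ∀ L f → bits L f < 2 ^ L
bits<2^ L f = subst (bits L f <_) (∏<-const L 2) (mixedRadix<∏ L _ _ (λ i _ → bit<2 (f i)))

bits-injective : ∀ L f g → bits L f ≡ bits L g → ∀ i → i < L → f i ≡ g i
bits-injective L f g eq i i<L = bit-injective
  (mixedRadix-injective L _ _ _ (λ j _ → bit<2 (f j)) (λ j _ → bit<2 (g j)) eq i i<L)

bits-positive : ∀ L f t → t < L → f t ≡ true → 0 < bits L f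
bits-positive (suc L) f t t<1+L ft with m<1+n⇒m<n∨m≡n t<1+L
... | inj₂ refl rewrite ft = s≤s z≤n
... | inj₁ t<L = <-≤-trans (bits-positive L f t t<L ft)
                   (≤-trans (m≤n*m (bits L f) 2) (m≤n+m _ (bit (f L))))

-- the least t < L with f t ≡ true, and L if there is none
first : ℕ → (ℕ → Bool) → ℕ
first zero    f = zero
first (suc L) f = if f 0 then 0 else suc (first L (f ∘ suc))

first-true : ∀ L f → first L f < L → f (first L f) ≡ true
first-true (suc L) f lt with f 0 in f0
... | true  = f0
... | false = first-true L (f ∘ suc) (s<s⁻¹ lt)

first< : ∀ L f t → t < L → f t ≡ true → first L f < L
first< (suc L) f t t<L ft with f 0 in f0
first< (suc L) f t       t<L ft | true  = z<s
first< (suc L) f zero    t<L ft | false = contradiction (trans (sym f0) ft) λ ()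
first< (suc L) f (suc t) t<L ft | false = s<s (first< L (f ∘ suc) t (s<s⁻¹ t<L) ft)

first-none : ∀ L f → ¬ first L f < L → ∀ t → t < L → f t ≡ false
first-none L f none t t<L with f t in ft
... | true  = ⊥-elim (none (first< L f t t<L ft))
... | false = refl

-- Either f or g vanishes below L, or both are the indicator of one common point.
CrossDiagonal : ℕ → (ℕ → Bool) → (ℕ → Bool) → Set
CrossDiagonal L f g = ∀ s s' → s < L → s' < L → f s ≡ true → g s' ≡ true → s ≡ s'

IsIndicator : ℕ → (ℕ → Bool) → ℕ → Set
IsIndicator L f t = (∀ s → s < L → f s ≡ true → s ≡ t) × f t ≡ true

indicator-unique : ∀ {L f f' t} → IsIndicator L f t → IsIndicator L f' t →
  ∀ s → s < L → f s ≡ f' s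
indicator-unique {f = f} {f'} (only , ft) (only' , f't) s s<L with f s in fs | f' s in f's
... | true  | true  = refl
... | false | false = refl
... | true  | false with refl ← only s s<L fs = trans (sym f't) f's
... | false | true  with refl ← only' s s<L f's = trans (sym fs) ft

crossDiagonal⇒indicators : ∀ {L f g} → CrossDiagonal L f g → first L f < L → first L g < L →
  IsIndicator L f (first L f) × IsIndicator L g (first L f)
crossDiagonal⇒indicators {L} {f} {g} cross f≢0 g≢0 =
  ((λ s s<L fs → trans (cross s t' s<L g≢0 fs gt') (sym t≡t')) , ft) ,
  ((λ s s<L gs → sym (cross t s f≢0 s<L ft gs)) , subst (λ z → g z ≡ true) (sym t≡t') gt')
  where
  t t' : ℕ
  t  = first L f
  t' = first L g
  ft : f t ≡ true
  ft = first-true L f f≢0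
  gt' : g t' ≡ true
  gt' = first-true L g g≢0
  t≡t' : t ≡ t'
  t≡t' = cross t t' f≢0 g≢0 ft gt'

bits-nonZero : ∀ L {f} → first L f < L → NonZero (bits L f)
bits-nonZero L f≢0 = >-nonZero (bits-positive L _ _ f≢0 (first-true L _ f≢0))

-- The three cases of CrossDiagonal get the disjoint ranges [L, L + 2^L), [L + 2^L, …) and [0, L);
-- when only g vanishes, f does not, so bits L f ≥ 1 and its predecessor still fits.
pairCode : ℕ → (ℕ → Bool) → (ℕ → Bool) → ℕ
pairCode L f g with first L f <? L | first L g <? L
... | no _  | _     = L + bits L g
... | yes _ | no _  = L + 2 ^ L + pred (bits L f)
... | yes _ | yes _ = first L f

data PairCodeView (L : ℕ) (f g : ℕ → Bool) : ℕ → Set where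
  f-vanishes : ¬ first L f < L → PairCodeView L f g (L + bits L g)
  g-vanishes : first L f < L → ¬ first L g < L → PairCodeView L f g (L + 2 ^ L + pred (bits L f))
  indicators : first L f < L → first L g < L → PairCodeView L f g (first L f)

pairCodeView : ∀ L f g → PairCodeView L f g (pairCode L f g)
pairCodeView L f g with first L f <? L | first L g <? L
... | no f≡0   | _        = f-vanishes f≡0
... | yes f≢0  | no g≡0   = g-vanishes f≢0 g≡0
... | yes f≢0  | yes g≢0  = indicators f≢0 g≢0

pairCodeBound : ℕ → ℕ
pairCodeBound L = L + 2 ^ L + pred (2 ^ L)

private
  below-g-vanishes : ∀ L g x → L + bits L g < L + 2 ^ L + x
  below-g-vanishes L g x = <-≤-trans (+-monoʳ-< L (bits<2^ L g)) (m≤m+n (L + 2 ^ L) x)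

  below-indicators : ∀ {L t} x → t < L → t < L + x
  below-indicators {L} x t<L = <-≤-trans t<L (m≤m+n L x)

pairCode< : ∀ L f g → pairCode L f g < pairCodeBound L
pairCode< L f g = view< (pairCodeView L f g)
  where
  view< : ∀ {c} → PairCodeView L f g c → c < pairCodeBound L
  view< (f-vanishes _)     = below-g-vanishes L g _
  view< (g-vanishes f≢0 _) = +-monoʳ-< (L + 2 ^ L) (pred-mono-< {{bits-nonZero L f≢0}} (bits<2^ L f))
  view< (indicators f≢0 _) = below-indicators _ (below-indicators _ f≢0)

pairCode-injective : ∀ L f g f' g' → CrossDiagonal L f g → CrossDiagonal L f' g' →
  pairCode L f g ≡ pairCode L f' g' → ∀ s → s < L → f s ≡ f' s × g s ≡ g' s
pairCode-injective L f g f' g' cross cross' =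
  views-injective (pairCodeView L f g) (pairCodeView L f' g')
  where
  vanish : ∀ {h h'} → ¬ first L h < L → ¬ first L h' < L → ∀ s → s < L → h s ≡ h' s
  vanish none none' s s<L = trans (first-none L _ none s s<L) (sym (first-none L _ none' s s<L))
  views-injective : ∀ {c c'} → PairCodeView L f g c → PairCodeView L f' g' c' →
    c ≡ c' → ∀ s → s < L → f s ≡ f' s × g s ≡ g' s
  views-injective (f-vanishes f≡0) (f-vanishes f'≡0) eq s s<L =
    vanish f≡0 f'≡0 s s<L , bits-injective L g g' (+-cancelˡ-≡ L _ _ eq) s s<L
  views-injective (g-vanishes f≢0 g≡0) (g-vanishes f'≢0 g'≡0) eq s s<L =
    bits-injective L f f' (pred-injective {{bits-nonZero L f≢0}} {{bits-nonZero L f'≢0}}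
      (+-cancelˡ-≡ (L + 2 ^ L) _ _ eq)) s s<L ,
    vanish g≡0 g'≡0 s s<L
  views-injective (indicators f≢0 g≢0) (indicators f'≢0 g'≢0) eq s s<L
    with crossDiagonal⇒indicators cross f≢0 g≢0 | crossDiagonal⇒indicators cross' f'≢0 g'≢0
  ... | ind-f , ind-g | ind-f' , ind-g' rewrite eq =
    indicator-unique ind-f ind-f' s s<L , indicator-unique ind-g ind-g' s s<L
  views-injective (f-vanishes _) (g-vanishes _ _) eq =
    ⊥-elim (<-irrefl eq (below-g-vanishes L g _))
  views-injective (g-vanishes _ _) (f-vanishes _) eq =
    ⊥-elim (<-irrefl (sym eq) (below-g-vanishes L g' _))
  views-injective (f-vanishes _) (indicators f'≢0 _) eq =
    ⊥-elim (<-irrefl (sym eq) (below-indicators _ f'≢0))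
  views-injective (indicators f≢0 _) (f-vanishes _) eq =
    ⊥-elim (<-irrefl eq (below-indicators _ f≢0))
  views-injective (g-vanishes _ _) (indicators f'≢0 _) eq =
    ⊥-elim (<-irrefl (sym eq) (below-indicators _ (below-indicators _ f'≢0)))
  views-injective (indicators f≢0 _) (g-vanishes _ _) eq =
    ⊥-elim (<-irrefl eq (below-indicators _ (below-indicators _ f≢0)))

Unique-lookup-injective : ∀ {A : Set} {xs : List A} → Unique xs →
  ∀ {i j : Fin (length xs)} → i <ᶠ j → lookup xs i ≢ lookup xs j
Unique-lookup-injective (x∉xs AllPairs.∷ _) {Fin.zero} {Fin.suc j} _ = All.lookup x∉xs (∈-lookup j)
Unique-lookup-injective (_ AllPairs.∷ unique) {Fin.suc i} {Fin.suc j} (s≤s i<j) =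
  Unique-lookup-injective unique i<j

pigeonholeℕ : ∀ {K n} → K < n → (f : Fin n → ℕ) → (∀ i → f i < K) →
  ∃₂ λ i j → i <ᶠ j × f i ≡ f j
pigeonholeℕ K<n f f<K with i , j , i<j , fᵢ≡fⱼ ← pigeonhole K<n (λ i → fromℕ< (f<K i)) =
  i , j , i<j , trans (sym (toℕ-fromℕ< _)) (trans (cong toℕ fᵢ≡fⱼ) (toℕ-fromℕ< _))

Unique⇒length≤ : ∀ {A : Set} {P : A → Set} {xs : List A} (K : ℕ) (code : A → ℕ) →
  (∀ {x} → P x → code x < K) → (∀ {x y} → P x → P y → code x ≡ code y → x ≡ y) →
  Unique xs → All P xs → length xs ≤ K
Unique⇒length≤ {P = P} {xs} K code code< code-injective unique all = ≮⇒≥ no-collision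
  where
  Pᵢ : ∀ i → P (lookup xs i)
  Pᵢ i = All.lookup all (∈-lookup i)
  no-collision : ¬ K < length xs
  no-collision K<length
    with i , j , i<j , codes≡ ← pigeonholeℕ K<length (code ∘ lookup xs) (code< ∘ Pᵢ) =
    Unique-lookup-injective unique i<j (code-injective (Pᵢ i) (Pᵢ j) codes≡)

data EvenOrOdd : ℕ → Set where
  even : ∀ k → EvenOrOdd (2 * k)
  odd  : ∀ k → EvenOrOdd (2 * k + 1)

evenOrOdd : ∀ x → EvenOrOdd x
evenOrOdd zero          = even 0
evenOrOdd (suc zero)    = odd 0
evenOrOdd (suc (suc x)) with evenOrOdd x
... | even k = subst EvenOrOdd (*-suc 2 k) (even (suc k))
... | odd k  = subst EvenOrOdd (cong (_+ 1) (*-suc 2 k)) (odd (suc k))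

⌊2k/2⌋≡k : ∀ k → ⌊ 2 * k /2⌋ ≡ k
⌊2k/2⌋≡k zero    = refl
⌊2k/2⌋≡k (suc k) = trans (cong ⌊_/2⌋ (*-suc 2 k)) (cong suc (⌊2k/2⌋≡k k))

⌊2k+1/2⌋≡k : ∀ k → ⌊ 2 * k + 1 /2⌋ ≡ k
⌊2k+1/2⌋≡k zero    = refl
⌊2k+1/2⌋≡k (suc k) = trans (cong (⌊_/2⌋ ∘ (_+ 1)) (*-suc 2 k)) (cong suc (⌊2k+1/2⌋≡k k))

2j≢2k+1 : ∀ j k → 2 * j ≢ 2 * k + 1
2j≢2k+1 j k eq = even≢odd j k (trans eq (+-comm (2 * k) 1))

2k<2m⇒k<m : ∀ k {m} → 2 * k < 2 * m → k < m
2k<2m⇒k<m k {m} = *-cancelˡ-< 2 k m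

2k+1<2m⇒k<m : ∀ k {m} → 2 * k + 1 < 2 * m → k < m
2k+1<2m⇒k<m k 2k+1<2m = 2k<2m⇒k<m k (<-trans (m<m+n (2 * k) z<s) 2k+1<2m)

2k+1<2m : ∀ {k m} → k < m → 2 * k + 1 < 2 * m
2k+1<2m {k} {m} k<m = begin-strict
  2 * k + 1 ≡⟨ +-comm (2 * k) 1 ⟩
  suc (2 * k) <⟨ n<1+n _ ⟩
  2 + 2 * k ≡⟨ *-suc 2 k ⟨
  2 * suc k ≤⟨ *-monoʳ-≤ 2 k<m ⟩
  2 * m     ∎
  where open ≤-Reasoning

lookupOr : ∀ {B : Set} {n} → Vec B n → ℕ → B → B
lookupOr []       _       default = default
lookupOr (x ∷ xs) zero    default = x
lookupOr (x ∷ xs) (suc i) default = lookupOr xs i default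

lookupOr-toℕ : ∀ {B : Set} {n} (v : Vec B n) (i : Fin n) default →
  lookupOr v (toℕ i) default ≡ Vec.lookup v i
lookupOr-toℕ (x ∷ v) Fin.zero    default = refl
lookupOr-toℕ (x ∷ v) (Fin.suc i) default = lookupOr-toℕ v i default

adjℕ : ∀ {N} → AdjMatrix N → ℕ → ℕ → Bool
adjℕ {N} A x y = lookupOr (lookupOr A x (replicate N false)) y false

entry≡adjℕ : ∀ {N} (A : AdjMatrix N) i j → entry A i j ≡ adjℕ A (toℕ i) (toℕ j)
entry≡adjℕ {N} A i j rewrite lookupOr-toℕ A i (replicate N false) =
  sym (lookupOr-toℕ (Vec.lookup A i) j false)

adjℕ≡entry : ∀ {N} (A : AdjMatrix N) {x y} (x<N : x < N) (y<N : y < N) →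
  adjℕ A x y ≡ entry A (fromℕ< x<N) (fromℕ< y<N)
adjℕ≡entry A x<N y<N =
  sym (trans (entry≡adjℕ A _ _) (cong₂ (adjℕ A) (toℕ-fromℕ< x<N) (toℕ-fromℕ< y<N)))

AdjNat⇒adjℕ : ∀ {N} (A : AdjMatrix N) {x y} → AdjNat A x y → adjℕ A x y ≡ true
AdjNat⇒adjℕ A (i , j , refl , refl , i~j) = trans (sym (entry≡adjℕ A i j)) i~j

adjℕ⇒AdjNat : ∀ {N} (A : AdjMatrix N) {x y} → x < N → y < N → adjℕ A x y ≡ true → AdjNat A x y
adjℕ⇒AdjNat A x<N y<N x~y =
  fromℕ< x<N , fromℕ< y<N , toℕ-fromℕ< x<N , toℕ-fromℕ< y<N , trans (sym (adjℕ≡entry A x<N y<N)) x~y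

adjℕ-irrefl : ∀ {N} (A : AdjMatrix N) → IsSimpleGraph A → ∀ {x} → x < N → adjℕ A x x ≡ false
adjℕ-irrefl A (irrefl , _) x<N = trans (adjℕ≡entry A x<N x<N) (irrefl _)

adjℕ-sym : ∀ {N} (A : AdjMatrix N) → IsSimpleGraph A →
  ∀ {x y} → x < N → y < N → adjℕ A x y ≡ adjℕ A y x
adjℕ-sym A (_ , sym-entry) x<N y<N =
  trans (adjℕ≡entry A x<N y<N) (trans (sym-entry _ _) (sym (adjℕ≡entry A y<N x<N)))

adjℕ-extensionality : ∀ {N} (A B : AdjMatrix N) →
  (∀ x y → x < N → y < N → adjℕ A x y ≡ adjℕ B x y) → A ≡ B
adjℕ-extensionality A B agree =
  trans (sym (tabulate∘lookup A)) (trans (tabulate-cong rows) (tabulate∘lookup B))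
  where
  entries : ∀ i j → entry A i j ≡ entry B i j
  entries i j = trans (entry≡adjℕ A i j) (trans (agree _ _ (toℕ<n i) (toℕ<n j)) (sym (entry≡adjℕ B i j)))
  rows : ∀ i → Vec.lookup A i ≡ Vec.lookup B i
  rows i = trans (sym (tabulate∘lookup _)) (trans (tabulate-cong (entries i)) (tabulate∘lookup _))

-- A labelling of the vertices by edge indices certifies that the endpoints are disjoint.
labelled-edges≤ : ∀ {N m} (A : AdjMatrix N) → NoLargerMatching m A →
  (k : ℕ) (p q label : ℕ → ℕ) → (∀ e → e < k → AdjNat A (p e) (q e)) →
  (∀ e → e < k → label (p e) ≡ e) → (∀ e → e < k → label (q e) ≡ e) → k ≤ m
labelled-edges≤ {N} A noLarger k p q label edge label-p label-q = noLarger k endpoints matching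
  where
  edge′ : (e : Fin k) → AdjNat A (p (toℕ e)) (q (toℕ e))
  edge′ e = edge (toℕ e) (toℕ<n e)
  endpoints : Fin k → Fin N × Fin N
  endpoints e = proj₁ (edge′ e) , proj₁ (proj₂ (edge′ e))
  label₁ : ∀ e → label (toℕ (proj₁ (endpoints e))) ≡ toℕ e
  label₁ e = trans (cong label (proj₁ (proj₂ (proj₂ (edge′ e))))) (label-p _ (toℕ<n e))
  label₂ : ∀ e → label (toℕ (proj₂ (endpoints e))) ≡ toℕ e
  label₂ e = trans (cong label (proj₁ (proj₂ (proj₂ (proj₂ (edge′ e)))))) (label-q _ (toℕ<n e))
  shared : ∀ {e f} {x y : Fin N} → label (toℕ x) ≡ toℕ e → label (toℕ y) ≡ toℕ f → x ≡ y → e ≡ f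
  shared lx ly refl = toℕ-injective (trans (sym lx) ly)
  matching : IsMatching A endpoints
  matching = (λ e → proj₂ (proj₂ (proj₂ (proj₂ (edge′ e))))) , λ e f e≢f →
    (e≢f ∘ shared (label₁ e) (label₁ f)) , (e≢f ∘ shared (label₁ e) (label₂ f)) ,
    (e≢f ∘ shared (label₂ e) (label₁ f)) , (e≢f ∘ shared (label₂ e) (label₂ f))

pairLabel : ℕ → ℕ → ℕ
pairLabel m z = if does (z <? 2 * m) then suc ⌊ z /2⌋ else 0

pairLabel-even : ∀ {m i} → i < m → pairLabel m (2 * i) ≡ suc i
pairLabel-even {m} {i} i<m rewrite dec-true (2 * i <? 2 * m) (*-monoʳ-< 2 i<m) = cong suc (⌊2k/2⌋≡k i)

pairLabel-odd : ∀ {m i} → i < m → pairLabel m (2 * i + 1) ≡ suc i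
pairLabel-odd {m} {i} i<m rewrite dec-true (2 * i + 1 <? 2 * m) (2k+1<2m i<m) = cong suc (⌊2k+1/2⌋≡k i)

pairLabel-unmatched : ∀ m {z} → 2 * m ≤ z → pairLabel m z ≡ 0
pairLabel-unmatched m {z} 2m≤z rewrite dec-false (z <? 2 * m) (≤⇒≯ 2m≤z) = refl

-- Labels certifying that M with {2k, 2k+1} traded for {2k, u} and {2k+1, u'} is a matching;
-- the two new edges get the labels suc k and 0.
swapLabel : ℕ → ℕ → ℕ → ℕ → ℕ
swapLabel m k u z = if does (z ≟ 2 * k + 1) then 0 else if does (z ≟ u) then suc k else pairLabel m z

swapLabel-other : ∀ m {k u z} → z ≢ 2 * k + 1 → z ≢ u → swapLabel m k u z ≡ pairLabel m z
swapLabel-other m {k} {u} {z} z≢2k+1 z≢u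
  rewrite dec-false (z ≟ 2 * k + 1) z≢2k+1 | dec-false (z ≟ u) z≢u = refl

module MaximumMatching {N m} (A : AdjMatrix N) (maximum : HasMaxMatchingM m A) (2m≤N : 2 * m ≤ N) where

  simple : IsSimpleGraph A
  simple = proj₁ maximum

  matched : ∀ {k} → k < m → adjℕ A (2 * k) (2 * k + 1) ≡ true
  matched k<m = AdjNat⇒adjℕ A (proj₁ (proj₂ maximum) _ k<m)

  private
    noLarger : NoLargerMatching m A
    noLarger = proj₂ (proj₂ maximum)

    edgeₘ : ∀ i → i < m → AdjNat A (2 * i) (2 * i + 1)
    edgeₘ = proj₁ (proj₂ maximum)

    matched<N : ∀ {z} → z < 2 * m → z < N
    matched<N z<2m = <-≤-trans z<2m 2m≤N

    unmatched<N : ∀ {t} → t < N ∸ 2 * m → 2 * m + t < N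
    unmatched<N t<n = subst (_ <_) (m+[n∸m]≡n 2m≤N) (+-monoʳ-< (2 * m) t<n)

  -- otherwise M together with that edge is a matching of size m + 1
  unmatched-independent : ∀ {x y} → 2 * m ≤ x → 2 * m ≤ y → x < N → y < N → adjℕ A x y ≡ false
  unmatched-independent {x} {y} 2m≤x 2m≤y x<N y<N with adjℕ A x y in x~y
  ... | false = refl
  ... | true  = contradiction (labelled-edges≤ A noLarger (suc m) p q label edge label-p label-q) 1+n≰n
    where
    p q label : ℕ → ℕ
    p zero    = x
    p (suc i) = 2 * i
    q zero    = y
    q (suc i) = 2 * i + 1
    label = pairLabel m
    edge : ∀ e → e < suc m → AdjNat A (p e) (q e)
    edge zero    _     = adjℕ⇒AdjNat A x<N y<N x~y
    edge (suc i) 1+i<m = edgeₘ i (s<s⁻¹ 1+i<m)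
    label-p : ∀ e → e < suc m → label (p e) ≡ e
    label-p zero    _     = pairLabel-unmatched m 2m≤x
    label-p (suc i) 1+i<m = pairLabel-even (s<s⁻¹ 1+i<m)
    label-q : ∀ e → e < suc m → label (q e) ≡ e
    label-q zero    _     = pairLabel-unmatched m 2m≤y
    label-q (suc i) 1+i<m = pairLabel-odd (s<s⁻¹ 1+i<m)

  -- otherwise u — 2k — 2k+1 — u' is an augmenting path for distinct unmatched u, u'
  neighbours-crossDiagonal : ∀ {k} → k < m →
    CrossDiagonal (N ∸ 2 * m) (λ s → adjℕ A (2 * k) (2 * m + s)) (λ s → adjℕ A (2 * k + 1) (2 * m + s))
  neighbours-crossDiagonal {k} k<m s s' s<n s'<n 2k~u 2k+1~u' with s ≟ s'
  ... | yes s≡s' = s≡s'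
  ... | no s≢s'  = contradiction (labelled-edges≤ A noLarger (suc m) p q label edge label-p label-q) 1+n≰n
    where
    u u' : ℕ
    u  = 2 * m + s
    u' = 2 * m + s'
    p q label : ℕ → ℕ
    p zero    = 2 * k + 1
    p (suc i) = 2 * i
    q zero    = u'
    q (suc i) with i ≟ k
    ... | yes _ = u
    ... | no _  = 2 * i + 1
    label = swapLabel m k u
    ≢2k+1 : ∀ {t} → 2 * m + t ≢ 2 * k + 1
    ≢2k+1 {t} = ≢-sym (<⇒≢ (<-≤-trans (2k+1<2m k<m) (m≤m+n (2 * m) t)))
    ≢u : ∀ {z} → z < 2 * m → z ≢ u
    ≢u z<2m = <⇒≢ (<-≤-trans z<2m (m≤m+n (2 * m) s))
    edge : ∀ e → e < suc m → AdjNat A (p e) (q e)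
    edge zero _ = adjℕ⇒AdjNat A (matched<N (2k+1<2m k<m)) (unmatched<N s'<n) 2k+1~u'
    edge (suc i) 1+i<m with i ≟ k
    ... | yes refl = adjℕ⇒AdjNat A (matched<N (*-monoʳ-< 2 k<m)) (unmatched<N s<n) 2k~u
    ... | no _     = edgeₘ i (s<s⁻¹ 1+i<m)
    label-p : ∀ e → e < suc m → label (p e) ≡ e
    label-p zero _ rewrite dec-true (2 * k + 1 ≟ 2 * k + 1) refl = refl
    label-p (suc i) 1+i<m = trans (swapLabel-other m (2j≢2k+1 i k) (≢u (*-monoʳ-< 2 i<m))) (pairLabel-even i<m)
      where i<m = s<s⁻¹ 1+i<m
    label-q : ∀ e → e < suc m → label (q e) ≡ e
    label-q zero _ = trans (swapLabel-other m ≢2k+1 (s≢s' ∘ sym ∘ +-cancelˡ-≡ (2 * m) s' s))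
                           (pairLabel-unmatched m (m≤m+n (2 * m) s'))
    label-q (suc i) 1+i<m with i ≟ k
    ... | yes refl rewrite dec-false (u ≟ 2 * k + 1) ≢2k+1 | dec-true (u ≟ u) refl = refl
    ... | no i≢k = trans (swapLabel-other m (i≢k ∘ *-cancelˡ-≡ i k 2 ∘ +-cancelʳ-≡ 1 (2 * i) (2 * k))
                                          (≢u (2k+1<2m i<m)))
                         (pairLabel-odd i<m)
      where i<m = s<s⁻¹ 1+i<m

-- Pair k of M is described by the rows of 2k and 2k+1 on the columns below 2k
-- and on the unmatched vertices; the remaining entries are forced by maximality.
module GraphCode (N m : ℕ) where

  n : ℕ
  n = N ∸ 2 * m

  lowBase : ℕ → ℕ
  lowBase k = 2 ^ (2 * k) * 2 ^ (2 * k)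

  lowRows : AdjMatrix N → ℕ → ℕ
  lowRows A k = bits (2 * k) (adjℕ A (2 * k)) + 2 ^ (2 * k) * bits (2 * k) (adjℕ A (2 * k + 1))

  unmatchedNeighbours : AdjMatrix N → ℕ → ℕ
  unmatchedNeighbours A k =
    pairCode n (λ s → adjℕ A (2 * k) (2 * m + s)) (λ s → adjℕ A (2 * k + 1) (2 * m + s))

  block : AdjMatrix N → ℕ → ℕ
  block A k = lowRows A k + lowBase k * unmatchedNeighbours A k

  base : ℕ → ℕ
  base k = lowBase k * pairCodeBound n

  code : AdjMatrix N → ℕ
  code A = mixedRadix m base (block A)

  lowRows< : ∀ A k → lowRows A k < lowBase k
  lowRows< A k = d+b*e<b*E (bits<2^ (2 * k) (adjℕ A (2 * k))) (bits<2^ (2 * k) (adjℕ A (2 * k + 1)))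

  block< : ∀ A k → block A k < base k
  block< A k = d+b*e<b*E (lowRows< A k) (pairCode< n _ _)

  code< : ∀ A → code A < ∏< m base
  code< A = mixedRadix<∏ m base (block A) (λ k _ → block< A k)

  module SameCode (2m≤N : 2 * m ≤ N) {A B : AdjMatrix N}
    (maxA : HasMaxMatchingM m A) (maxB : HasMaxMatchingM m B) (codes≡ : code A ≡ code B) where

    private
      module MA = MaximumMatching A maxA 2m≤N
      module MB = MaximumMatching B maxB 2m≤N

      matched<N : ∀ {z} → z < 2 * m → z < N
      matched<N z<2m = <-≤-trans z<2m 2m≤N

    blocks-agree : ∀ {k} → k < m →
      lowRows A k ≡ lowRows B k × unmatchedNeighbours A k ≡ unmatchedNeighbours B k
    blocks-agree {k} k<m = d+b*e-injective (lowRows< A k) (lowRows< B k)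
      (mixedRadix-injective m base (block A) (block B) (λ i _ → block< A i) (λ i _ → block< B i) codes≡ k k<m)

    lowRows-agree : ∀ {k} → k < m → ∀ j → j < 2 * k →
      adjℕ A (2 * k) j ≡ adjℕ B (2 * k) j × adjℕ A (2 * k + 1) j ≡ adjℕ B (2 * k + 1) j
    lowRows-agree {k} k<m j j<2k
      with even≡ , odd≡ ← d+b*e-injective (bits<2^ (2 * k) (adjℕ A (2 * k))) (bits<2^ (2 * k) (adjℕ B (2 * k)))
                                          (proj₁ (blocks-agree k<m)) =
      bits-injective _ (adjℕ A (2 * k)) _ even≡ j j<2k , bits-injective _ (adjℕ A (2 * k + 1)) _ odd≡ j j<2k

    unmatched-agree : ∀ {k} → k < m → ∀ s → s < n →
      adjℕ A (2 * k) (2 * m + s) ≡ adjℕ B (2 * k) (2 * m + s) ×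
      adjℕ A (2 * k + 1) (2 * m + s) ≡ adjℕ B (2 * k + 1) (2 * m + s)
    unmatched-agree k<m = pairCode-injective n _ _ _ _
      (MA.neighbours-crossDiagonal k<m) (MB.neighbours-crossDiagonal k<m) (proj₂ (blocks-agree k<m))

    flip : ∀ {x y} → x < N → y < N → adjℕ A y x ≡ adjℕ B y x → adjℕ A x y ≡ adjℕ B x y
    flip x<N y<N yx≡ = trans (adjℕ-sym A MA.simple x<N y<N) (trans yx≡ (adjℕ-sym B MB.simple y<N x<N))

    matched-unmatched : ∀ {x y} → x < 2 * m → 2 * m ≤ y → y < N → adjℕ A x y ≡ adjℕ B x y
    matched-unmatched {x} {y} x<2m 2m≤y y<N with evenOrOdd x
    ... | even k = subst (λ z → adjℕ A x z ≡ adjℕ B x z) (m+[n∸m]≡n 2m≤y)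
                     (proj₁ (unmatched-agree (2k<2m⇒k<m k x<2m) (y ∸ 2 * m) (∸-monoˡ-< y<N 2m≤y)))
    ... | odd k  = subst (λ z → adjℕ A x z ≡ adjℕ B x z) (m+[n∸m]≡n 2m≤y)
                     (proj₂ (unmatched-agree (2k+1<2m⇒k<m k x<2m) (y ∸ 2 * m) (∸-monoˡ-< y<N 2m≤y)))

    matched-matched : ∀ {x y} → x < y → y < 2 * m → adjℕ A x y ≡ adjℕ B x y
    matched-matched {x} {y} x<y y<2m with evenOrOdd y
    ... | even k = flip (<-trans x<y (matched<N y<2m)) (matched<N y<2m)
                     (proj₁ (lowRows-agree (2k<2m⇒k<m k y<2m) x x<y))
    ... | odd k with x <? 2 * k
    ...   | yes x<2k = flip (<-trans x<y (matched<N y<2m)) (matched<N y<2m)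
                         (proj₂ (lowRows-agree (2k+1<2m⇒k<m k y<2m) x x<2k))
    -- here x = 2k, so {x, y} is an edge of M
    ...   | no x≮2k rewrite ≤-antisym (s≤s⁻¹ (subst (x <_) (+-comm (2 * k) 1) x<y)) (≮⇒≥ x≮2k) =
      trans (MA.matched (2k+1<2m⇒k<m k y<2m)) (sym (MB.matched (2k+1<2m⇒k<m k y<2m)))

    agree-below : ∀ {x y} → x < y → y < N → adjℕ A x y ≡ adjℕ B x y
    agree-below {x} {y} x<y y<N with y <? 2 * m | x <? 2 * m
    ... | yes y<2m | _        = matched-matched x<y y<2m
    ... | no y≮2m  | yes x<2m = matched-unmatched x<2m (≮⇒≥ y≮2m) y<N
    ... | no y≮2m  | no x≮2m  = trans (MA.unmatched-independent (≮⇒≥ x≮2m) (≮⇒≥ y≮2m) x<N y<N)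
                                  (sym (MB.unmatched-independent (≮⇒≥ x≮2m) (≮⇒≥ y≮2m) x<N y<N))
      where x<N = <-trans x<y y<N

    agree : ∀ x y → x < N → y < N → adjℕ A x y ≡ adjℕ B x y
    agree x y x<N y<N with <-cmp x y
    ... | tri< x<y _ _ = agree-below x<y y<N
    ... | tri≈ _ refl _ = trans (adjℕ-irrefl A MA.simple x<N) (sym (adjℕ-irrefl B MB.simple x<N))
    ... | tri> _ _ y<x = flip x<N y<N (agree-below y<x x<N)

  code-injective : 2 * m ≤ N → ∀ {A B} → HasMaxMatchingM m A → HasMaxMatchingM m B →
    code A ≡ code B → A ≡ B
  code-injective 2m≤N {A} {B} maxA maxB codes≡ =
    adjℕ-extensionality A B (SameCode.agree 2m≤N {A} {B} maxA maxB codes≡)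

∏<-*-const : ∀ k (f : ℕ → ℕ) c → ∏< k (λ i → f i * c) ≡ ∏< k f * c ^ k
∏<-*-const zero    f c = refl
∏<-*-const (suc k) f c = trans (cong (f k * c *_) (∏<-*-const k f c)) (interchange (f k) c (∏< k f) (c ^ k))
  where
  interchange : ∀ a c p d → a * c * (p * d) ≡ a * p * (c * d)
  interchange = solve-∀

2[1+k]²∸2[1+k]≡2[1+k]k : ∀ k → 2 * suc k * suc k ∸ 2 * suc k ≡ 2 * suc k * k
2[1+k]²∸2[1+k]≡2[1+k]k k = trans (cong (_∸ 2 * suc k) (*-suc (2 * suc k) k)) (m+n∸m≡n (2 * suc k) _)

2k²∸2k-suc : ∀ k → 2 * suc k * suc k ∸ 2 * suc k ≡ 2 * k + 2 * k + (2 * k * k ∸ 2 * k)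
2k²∸2k-suc zero    = refl
2k²∸2k-suc (suc j) = begin
  2 * suc (suc j) * suc (suc j) ∸ 2 * suc (suc j)
    ≡⟨ 2[1+k]²∸2[1+k]≡2[1+k]k (suc j) ⟩
  2 * suc (suc j) * suc j
    ≡⟨ expand j ⟩
  2 * suc j + 2 * suc j + 2 * suc j * j
    ≡⟨ cong (2 * suc j + 2 * suc j +_) (2[1+k]²∸2[1+k]≡2[1+k]k j) ⟨
  2 * suc j + 2 * suc j + (2 * suc j * suc j ∸ 2 * suc j) ∎
  where
  open ≡-Reasoning
  expand : ∀ j → 2 * suc (suc j) * suc j ≡ 2 * suc j + 2 * suc j + 2 * suc j * j
  expand = solve-∀

∏<-lowBase : ∀ k → ∏< k (λ i → 2 ^ (2 * i) * 2 ^ (2 * i)) ≡ 2 ^ (2 * k * k ∸ 2 * k)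
∏<-lowBase zero    = refl
∏<-lowBase (suc k) = begin
  2 ^ (2 * k) * 2 ^ (2 * k) * ∏< k _          ≡⟨ cong (2 ^ (2 * k) * 2 ^ (2 * k) *_) (∏<-lowBase k) ⟩
  2 ^ (2 * k) * 2 ^ (2 * k) * 2 ^ (2 * k * k ∸ 2 * k)
    ≡⟨ cong (_* 2 ^ (2 * k * k ∸ 2 * k)) (^-distribˡ-+-* 2 (2 * k) (2 * k)) ⟨
  2 ^ (2 * k + 2 * k) * 2 ^ (2 * k * k ∸ 2 * k) ≡⟨ ^-distribˡ-+-* 2 (2 * k + 2 * k) _ ⟨
  2 ^ (2 * k + 2 * k + (2 * k * k ∸ 2 * k))     ≡⟨ cong (2 ^_) (2k²∸2k-suc k) ⟨
  2 ^ (2 * suc k * suc k ∸ 2 * suc k)          ∎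
  where open ≡-Reasoning

pairCodeBound< : ∀ L → pairCodeBound L < L + 2 ^ (L + 1)
pairCodeBound< L = begin-strict
  L + 2 ^ L + pred (2 ^ L) <⟨ +-monoʳ-< (L + 2 ^ L) (m≤pred[n]⇒suc[m]≤n {{m^n≢0 2 L}} ≤-refl) ⟩
  L + 2 ^ L + 2 ^ L        ≡⟨ +-assoc L (2 ^ L) (2 ^ L) ⟩
  L + (2 ^ L + 2 ^ L)      ≡⟨ cong (λ e → L + (2 ^ L + e)) (+-identityʳ (2 ^ L)) ⟨
  L + 2 ^ (1 + L)          ≡⟨ cong (λ e → L + 2 ^ e) (+-comm 1 L) ⟩
  L + 2 ^ (L + 1)          ∎
  where open ≤-Reasoning

lemma17 : (N m : ℕ) → 1 ≤ m → 2 * m ≤ N →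
    (gs : List (AdjMatrix N)) → Unique gs → All (HasMaxMatchingM m) gs →
    length gs < 2 ^ (2 * m * m ∸ 2 * m) * (N ∸ 2 * m + 2 ^ (N ∸ 2 * m + 1)) ^ m
lemma17 N m 1≤m 2m≤N gs unique maximum = begin-strict
  length gs
    ≤⟨ Unique⇒length≤ _ code (λ {A} _ → code< A) (code-injective 2m≤N) unique maximum ⟩
  ∏< m base
    ≡⟨ ∏<-*-const m lowBase (pairCodeBound n) ⟩
  ∏< m lowBase * pairCodeBound n ^ m
    ≡⟨ cong (_* pairCodeBound n ^ m) (∏<-lowBase m) ⟩
  2 ^ e * pairCodeBound n ^ m
    <⟨ *-monoʳ-< (2 ^ e) {{m^n≢0 2 e}} (^-monoˡ-< m {{>-nonZero 1≤m}} (pairCodeBound< n)) ⟩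
  2 ^ e * (n + 2 ^ (n + 1)) ^ m ∎
  where
  open GraphCode N m
  open ≤-Reasoning
  e : ℕ
  e = 2 * m * m ∸ 2 * m
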